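{- Let $\Gamma$ be an Abelian group and let $G$ be a $\Gamma$-labelled graph containing a vertex set $B$ such that every $B$-path has weight zero. Let $M$ be the set of vertices $v$ that have three paths to $B\setminus\{v\}$ which pairwise meet only in $v$. Then for each $v\in M$ there is a $\gamma_v\in\Gamma_2$ such that all paths from $v$ to $B$ have weight $\gamma_v$. Moreover, if $v,w\in M$ are such that all paths from $v$ to $B$ and all paths from $w$ to $B$ are zero, then all paths with endvertices $v$ and $w$ are zero.
   Context: The weight of a path is the sum of its edge weights (a trivial path has weight $0$); a path is zero if its weight is $0$. For $B\subseteq V(G)$, a $B$-path is a non-trivial path with both endvertices in $B$ and no vertex of $B$ in its interior. $\Gamma_2=\{\gamma\in\Gamma: 2\gamma=0\}$. -}

module Defs where

open import Level using (Level; _⊔_; suc)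
open import Data.Nat using (ℕ)
open import Data.Fin using (Fin)
open import Data.Product using (_×_; _,_; Σ)
open import Data.Sum using (_⊎_)
open import Data.List using (List; []; _∷_)
open import Data.List.Membership.Propositional using (_∈_)
open import Data.List.Relation.Unary.Unique.Propositional using (Unique)
open import Data.List.Relation.Unary.All using (All)
open import Relation.Binary.PropositionalEquality using (_≡_; _≢_)
open import Relation.Nullary using (¬_)
open import Algebra.Bundles using (AbelianGroup)

record LGraph {a : Level} (A : Set a) : Set a where
  field
    nV    : ℕ
    nE    : ℕ
    ends  : Fin nE → Fin nV × Fin nV
    label : Fin nE → A

module _ {a : Level} {A : Set a} (G : LGraph A) where
  open LGraph G

  Joins : Fin nE → Fin nV → Fin nV → Set
  Joins e u v = (ends e ≡ (u , v)) ⊎ (ends e ≡ (v , u))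

  data Walk : Fin nV → Fin nV → Set where
    stop : (v : Fin nV) → Walk v v
    step : {u v w : Fin nV} (e : Fin nE) → Joins e u v → Walk v w → Walk u w

  verts : {u w : Fin nV} → Walk u w → List (Fin nV)
  verts (stop v) = v ∷ []
  verts (step {u = u} e j r) = u ∷ verts r

  inner : {u w : Fin nV} → Walk u w → List (Fin nV)
  inner (stop v) = []
  inner (step e j (stop _)) = []
  inner (step {v = v} e j r@(step _ _ _)) = v ∷ inner r

  edgeLabels : {u w : Fin nV} → Walk u w → List A
  edgeLabels (stop v) = []
  edgeLabels (step e j r) = label e ∷ edgeLabels r

  IsPath : {u w : Fin nV} → Walk u w → Set
  IsPath P = Unique (verts P)

  NonTrivial : {u w : Fin nV} → Walk u w → Set
  NonTrivial (stop v) = Data.Empty.⊥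
    where import Data.Empty
  NonTrivial (step e j r) = Data.Unit.⊤
    where import Data.Unit

  IsBPath : {ℓb : Level} (B : Fin nV → Set ℓb) {u w : Fin nV} → Walk u w → Set ℓb
  IsBPath B {u} {w} P = IsPath P × NonTrivial P × B u × B w × All (λ x → ¬ B x) (inner P)

  PathToB : {ℓb : Level} (B : Fin nV → Set ℓb) (v : Fin nV) → Set ℓb
  PathToB B v = Σ (Fin nV) λ w → Σ (Walk v w) λ P →
    IsPath P × B w × All (λ x → ¬ B x) (init P)
    where
      init : {u w : Fin nV} → Walk u w → List (Fin nV)
      init (stop _) = []
      init (step {u = u} e j r) = u ∷ init r

  MeetOnlyIn : {w₁ w₂ : Fin nV} (v : Fin nV) → Walk v w₁ → Walk v w₂ → Set
  MeetOnlyIn v P Q = ∀ x → x ∈ verts P → x ∈ verts Q → x ≡ v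

module _ {c ℓ : Level} (Γ : AbelianGroup c ℓ) where
  open AbelianGroup Γ renaming (Carrier to Γ₀)

  weight : {G : LGraph Γ₀} {u w : Fin (LGraph.nV G)} → Walk G u w → Γ₀
  weight {G} P = go (edgeLabels G P)
    where
      go : List Γ₀ → Γ₀
      go [] = ε
      go (x ∷ xs) = x ∙ go xs

  InΓ₂ : Γ₀ → Set ℓ
  InΓ₂ γ = (γ ∙ γ) ≈ ε

  module _ (G : LGraph Γ₀) {ℓb : Level} (B : Fin (LGraph.nV G) → Set ℓb) where
    open LGraph G

    InM : Fin nV → Set (ℓb)
    InM v = Σ (PathToB G B' v) λ P₁ → Σ (PathToB G B' v) λ P₂ → Σ (PathToB G B' v) λ P₃ →
        MeetOnlyIn G v (pw P₁) (pw P₂) × MeetOnlyIn G v (pw P₁) (pw P₃)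
      × MeetOnlyIn G v (pw P₂) (pw P₃)
      where
        B' : Fin nV → Set ℓb
        B' x = B x × (x ≢ v)
        pw : (P : PathToB G B' v) → Walk G v (Data.Product.proj₁ P)
        pw P = Data.Product.proj₁ (Data.Product.proj₂ P)

    AllPathsToBWeigh : Fin nV → Γ₀ → Set (ℓ ⊔ ℓb)
    AllPathsToBWeigh v γ = (P : PathToB G B v) →
      weight {G} (Data.Product.proj₁ (Data.Product.proj₂ P)) ≈ γ

-- Two paths from v ∉ B to B that meet only in v form a B-path, so their weights are
-- mutually inverse; for three such paths X, Y, Z this gives w X = -w Z = w Y = -w X.
-- Every path Q from v to B has weight w X, by induction on the part of Q beyond a
-- common prefix with X: where Q next meets X ∪ Y ∪ Z, either X or Y can be rerouted
-- along Q, extending the common prefix, or new triples of paths arise at the two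
-- branch points which determine the weights involved. For the second claim, B ∪ {w}
-- still has only zero B-paths (a new one is a path from w to B). Cut at B ∪ {w}, one
-- of the three paths from v avoids w, so it is a zero path to B; hence all paths from
-- v to B ∪ {w} are zero, and a path from v to w splits into such a path and
-- (B ∪ {w})-paths.

module Submission where

open import Defs
open import Level using (Level)
open import Data.Fin using (Fin; _≟_)
open import Data.Fin.Subset using (Subset; _∈_)
open import Data.Fin.Subset.Properties using (_∈?_)
open import Data.Product using (Σ; _×_; _,_; proj₁; proj₂)
open import Algebra.Bundles using (AbelianGroup)

open import Data.Nat using (ℕ; zero; suc; _≤_; s≤s)
open import Data.Nat.Properties using (≤-refl; ≤-trans; n≤1+n)
open import Data.Sum using (_⊎_; inj₁; inj₂)
open import Data.Unit using (tt)
open import Data.Empty using (⊥-elim)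
open import Data.List using ([]; _∷_)
open import Data.List.Relation.Unary.Any using (here; there)
open import Data.List.Relation.Unary.All using (All; []; _∷_)
open import Data.List.Relation.Unary.All.Properties using (¬Any⇒All¬)
open import Data.List.Relation.Unary.AllPairs using ([]; _∷_; tail)
open import Data.List.Relation.Unary.Unique.Propositional using (Unique)
open import Data.List.Relation.Unary.Unique.Propositional.Properties using (Unique[x∷xs]⇒x∉xs)
open import Data.List.Membership.Propositional using () renaming (_∈_ to _∈ₗ_)
import Data.List.Membership.DecPropositional as DecMembership
open import Function using (id; _∘_)
open import Relation.Nullary using (¬_; Dec; yes; no)
open import Relation.Nullary.Decidable using (_⊎-dec_)
open import Relation.Unary using (Decidable)
open import Relation.Binary.PropositionalEquality using (_≡_; _≢_; refl; sym; trans; cong; subst)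
import Relation.Binary.Reasoning.Setoid as ≈-Reasoning
import Algebra.Properties.Group as GroupProperties

module Walks {a : Level} {A : Set a} (G : LGraph A) where

  V : Set
  V = Fin (LGraph.nV G)

  open DecMembership {A = V} _≟_ using () renaming (_∈?_ to _∈ₗ?_)

  private variable
    s t u v w x : V

  infix 4 _∈ᵥ_
  _∈ᵥ_ : V → Walk G u w → Set
  x ∈ᵥ P = x ∈ₗ verts G P

  infixr 5 _++_
  _++_ : Walk G u v → Walk G v w → Walk G u w
  stop _ ++ Q = Q
  step e j P ++ Q = step e j (P ++ Q)

  ++-assoc : (P : Walk G u v) (Q : Walk G v w) (R : Walk G w x) →
    (P ++ Q) ++ R ≡ P ++ (Q ++ R)
  ++-assoc (stop _) Q R = refl
  ++-assoc (step e j P) Q R = cong (step e j) (++-assoc P Q R)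

  Joins-sym : ∀ {e} → Joins G e u v → Joins G e v u
  Joins-sym (inj₁ p) = inj₂ p
  Joins-sym (inj₂ p) = inj₁ p

  reverse : Walk G u w → Walk G w u
  reverse (stop v) = stop v
  reverse (step {u = u} e j P) = reverse P ++ step e (Joins-sym j) (stop u)

  length : Walk G u w → ℕ
  length (stop _) = 0
  length (step e j P) = suc (length P)

  length-suffix-≤ : (P : Walk G u v) (Q : Walk G v w) → length Q ≤ length (P ++ Q)
  length-suffix-≤ (stop _) Q = ≤-refl
  length-suffix-≤ (step e j P) Q = ≤-trans (length-suffix-≤ P Q) (n≤1+n _)

  infix 4 _∈ᵥ?_
  _∈ᵥ?_ : (x : V) (P : Walk G u w) → Dec (x ∈ᵥ P)
  x ∈ᵥ? P = x ∈ₗ? verts G P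

  MeetOnlyAt : V → Walk G s t → Walk G u w → Set
  MeetOnlyAt v P Q = ∀ x → x ∈ᵥ P → x ∈ᵥ Q → x ≡ v

  MeetOnlyAt-sym : {P : Walk G s t} {Q : Walk G u w} → MeetOnlyAt v P Q → MeetOnlyAt v Q P
  MeetOnlyAt-sym m x p q = m x q p

  source∈ : (P : Walk G u w) → u ∈ᵥ P
  source∈ (stop _) = here refl
  source∈ (step e j P) = here refl

  target∈ : (P : Walk G u w) → w ∈ᵥ P
  target∈ (stop _) = here refl
  target∈ (step e j P) = there (target∈ P)

  ∈-stop : x ∈ᵥ stop v → x ≡ v
  ∈-stop (here p) = p

  ∈-++⁻ : (P : Walk G u v) (Q : Walk G v w) → x ∈ᵥ P ++ Q → x ∈ᵥ P ⊎ x ∈ᵥ Q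
  ∈-++⁻ (stop _) Q m = inj₂ m
  ∈-++⁻ (step e j P) Q (here p) = inj₁ (here p)
  ∈-++⁻ (step e j P) Q (there m) with ∈-++⁻ P Q m
  ... | inj₁ m' = inj₁ (there m')
  ... | inj₂ m' = inj₂ m'

  ∈-++⁺ˡ : (P : Walk G u v) (Q : Walk G v w) → x ∈ᵥ P → x ∈ᵥ P ++ Q
  ∈-++⁺ˡ (stop _) Q (here refl) = source∈ Q
  ∈-++⁺ˡ (step e j P) Q (here p) = here p
  ∈-++⁺ˡ (step e j P) Q (there m) = there (∈-++⁺ˡ P Q m)

  ∈-++⁺ʳ : (P : Walk G u v) (Q : Walk G v w) → x ∈ᵥ Q → x ∈ᵥ P ++ Q
  ∈-++⁺ʳ (stop _) Q m = m
  ∈-++⁺ʳ (step e j P) Q m = there (∈-++⁺ʳ P Q m)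

  ∈-reverse⁻ : (P : Walk G u w) → x ∈ᵥ reverse P → x ∈ᵥ P
  ∈-reverse⁻ (stop _) m = m
  ∈-reverse⁻ (step e j P) m with ∈-++⁻ (reverse P) (step e (Joins-sym j) (stop _)) m
  ... | inj₁ m' = there (∈-reverse⁻ P m')
  ... | inj₂ (here refl) = there (source∈ P)
  ... | inj₂ (there (here refl)) = here refl

  private
    source∉tail : ∀ {xs} → Unique (u ∷ xs) → ¬ u ∈ₗ xs
    source∉tail = Unique[x∷xs]⇒x∉xs

    unique-∷ : ∀ {xs} → ¬ u ∈ₗ xs → Unique xs → Unique (u ∷ xs)
    unique-∷ u∉xs p = ¬Any⇒All¬ _ u∉xs ∷ p

  IsPath-++ : (P : Walk G u v) (Q : Walk G v w) → IsPath G P → IsPath G Q →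
    MeetOnlyAt v P Q → IsPath G (P ++ Q)
  IsPath-++ (stop _) Q _ q _ = q
  IsPath-++ (step {u = u} e j P) Q p q m =
    unique-∷ u∉P++Q (IsPath-++ P Q (tail p) q (λ x x∈P → m x (there x∈P)))
    where
      u∉P++Q : ¬ u ∈ᵥ P ++ Q
      u∉P++Q u∈ with ∈-++⁻ P Q u∈
      ... | inj₁ u∈P = source∉tail p u∈P
      ... | inj₂ u∈Q = source∉tail p (subst (_∈ᵥ P) (sym (m u (here refl) u∈Q)) (target∈ P))

  IsPath-prefix : (P : Walk G u v) (Q : Walk G v w) → IsPath G (P ++ Q) → IsPath G P
  IsPath-prefix (stop _) Q _ = [] ∷ []
  IsPath-prefix (step e j P) Q pq =
    unique-∷ (λ u∈P → source∉tail pq (∈-++⁺ˡ P Q u∈P)) (IsPath-prefix P Q (tail pq))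

  IsPath-suffix : (P : Walk G u v) (Q : Walk G v w) → IsPath G (P ++ Q) → IsPath G Q
  IsPath-suffix (stop _) Q pq = pq
  IsPath-suffix (step e j P) Q pq = IsPath-suffix P Q (tail pq)

  IsPath-++⇒MeetOnlyAt : (P : Walk G u v) (Q : Walk G v w) → IsPath G (P ++ Q) → MeetOnlyAt v P Q
  IsPath-++⇒MeetOnlyAt (stop _) Q _ x x∈P _ = ∈-stop x∈P
  IsPath-++⇒MeetOnlyAt (step e j P) Q pq x (here refl) x∈Q = ⊥-elim (source∉tail pq (∈-++⁺ʳ P Q x∈Q))
  IsPath-++⇒MeetOnlyAt (step e j P) Q pq x (there x∈P) x∈Q =
    IsPath-++⇒MeetOnlyAt P Q (tail pq) x x∈P x∈Q

  IsPath-reverse : (P : Walk G u w) → IsPath G P → IsPath G (reverse P)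
  IsPath-reverse (stop _) p = p
  IsPath-reverse (step {u = u} {v = v} e j P) p =
    IsPath-++ (reverse P) edge (IsPath-reverse P (tail p)) edgeIsPath meet
    where
      edge = step e (Joins-sym j) (stop u)
      edgeIsPath : IsPath G edge
      edgeIsPath =
        unique-∷ (λ v≡u → source∉tail p (subst (_∈ᵥ P) (∈-stop v≡u) (source∈ P))) ([] ∷ [])
      meet : MeetOnlyAt v (reverse P) edge
      meet x _ (here x≡v) = x≡v
      meet x x∈P (there (here refl)) = ⊥-elim (source∉tail p (∈-reverse⁻ P x∈P))

  closedPath-trivial : (P : Walk G u w) → IsPath G P → w ≡ u → x ∈ᵥ P → x ≡ u
  closedPath-trivial (stop _) _ _ m = ∈-stop m
  closedPath-trivial (step e j P) _ _ (here x≡u) = x≡u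
  closedPath-trivial (step e j P) p refl (there _) = ⊥-elim (source∉tail p (target∈ P))

  data FirstHit (S : V → Set) (Q : Walk G u w) : Set where
    miss : (∀ x → x ∈ᵥ Q → ¬ S x) → FirstHit S Q
    hit : (Q₁ : Walk G u t) (Q₂ : Walk G t w) → Q₁ ++ Q₂ ≡ Q → S t →
      (∀ x → x ∈ᵥ Q₁ → S x → x ≡ t) → FirstHit S Q

  firstHit : (S : V → Set) → Decidable S → (Q : Walk G u w) → FirstHit S Q
  firstHit S S? (stop u) with S? u
  ... | yes p = hit (stop u) (stop u) refl p (λ x m _ → ∈-stop m)
  ... | no ¬p = miss (λ { x (here refl) → ¬p })
  firstHit S S? (step {u = u} e j Q) with S? u
  ... | yes p = hit (stop u) (step e j Q) refl p (λ x m _ → ∈-stop m)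
  ... | no ¬p with firstHit S S? Q
  ...   | miss h = miss (λ { x (here refl) → ¬p ; x (there m) → h x m })
  ...   | hit Q₁ Q₂ refl st first = hit (step e j Q₁) Q₂ refl st
            (λ { x (here refl) sx → ⊥-elim (¬p sx) ; x (there m) sx → first x m sx })

  splitAt : (Q : Walk G u w) → t ∈ᵥ Q →
    Σ (Walk G u t) λ Q₁ → Σ (Walk G t w) λ Q₂ → Q₁ ++ Q₂ ≡ Q
  splitAt {t = t} Q t∈Q with firstHit (_≡ t) (_≟ t) Q
  ... | miss h = ⊥-elim (h t t∈Q refl)
  ... | hit Q₁ Q₂ eq refl _ = Q₁ , Q₂ , eq

  MeetsOnlyAtEnds : (B : V → Set) {u w : V} → Walk G u w → Set
  MeetsOnlyAtEnds B {u} {w} P = ∀ x → x ∈ᵥ P → B x → x ≡ u ⊎ x ≡ w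

  MeetsOnlyAtEnds-⊆ : ∀ {B B′} → (∀ {x} → B x → B′ x) → {P : Walk G u w} →
    MeetsOnlyAtEnds B′ P → MeetsOnlyAtEnds B P
  MeetsOnlyAtEnds-⊆ B⊆B′ onlyAtEnds x x∈P x∈B = onlyAtEnds x x∈P (B⊆B′ x∈B)

  record IsPathToB (B : V → Set) (P : Walk G u w) : Set where
    constructor pathToB
    field
      isPath : IsPath G P
      target∈B : B w
      meetsBOnlyAtTarget : ∀ x → x ∈ᵥ P → B x → x ≡ w

  IsPathToB-suffix : ∀ {B} (P : Walk G u v) (Q : Walk G v w) → IsPathToB B (P ++ Q) → IsPathToB B Q
  IsPathToB-suffix P Q (pathToB p b only) =
    pathToB (IsPath-suffix P Q p) b (λ x x∈Q → only x (∈-++⁺ʳ P Q x∈Q))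

  record Tripod (B : V → Set) {v x y z} (X : Walk G v x) (Y : Walk G v y) (Z : Walk G v z) : Set where
    constructor tripod
    field
      X-toB : IsPathToB B X
      Y-toB : IsPathToB B Y
      Z-toB : IsPathToB B Z
      X∩Y : MeetOnlyAt v X Y
      X∩Z : MeetOnlyAt v X Z
      Y∩Z : MeetOnlyAt v Y Z

  OnTripod : Walk G v x → Walk G v u → Walk G v w → V → Set
  OnTripod X Y Z a = a ∈ᵥ X ⊎ a ∈ᵥ Y ⊎ a ∈ᵥ Z

  onTripod? : (X : Walk G v x) (Y : Walk G v u) (Z : Walk G v w) → Decidable (OnTripod X Y Z)
  onTripod? X Y Z a = (a ∈ᵥ? X) ⊎-dec (a ∈ᵥ? Y) ⊎-dec (a ∈ᵥ? Z)

  Tripod-swap₁₂ : ∀ {B} {X : Walk G v x} {Y : Walk G v u} {Z : Walk G v w} →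
    Tripod B X Y Z → Tripod B Y X Z
  Tripod-swap₁₂ (tripod x y z xy xz yz) = tripod y x z (MeetOnlyAt-sym xy) yz xz

  Tripod-swap₂₃ : ∀ {B} {X : Walk G v x} {Y : Walk G v u} {Z : Walk G v w} →
    Tripod B X Y Z → Tripod B X Z Y
  Tripod-swap₂₃ (tripod x y z xy xz yz) = tripod x z y xz xy (MeetOnlyAt-sym yz)

  private
    fibres : {I : Set} {F : I → Set} → (Σ I F → Σ I F) → I → Set
    fibres {F = F} _ = F

  -- PathToB names its conditions on a single walk only inside a where block, so they
  -- are recovered as the fibres of its Σ-type.
  PathToBConditions : (B : V → Set) {v w : V} → Walk G v w → Set
  PathToBConditions B {v} {w} = fibres (id {A = fibres (id {A = PathToB G B v}) w})

  conditions⇒IsPathToB : ∀ {B} (P : Walk G v w) → PathToBConditions B P → IsPathToB B P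
  conditions⇒IsPathToB (stop _) (p , w∈B , []) = pathToB p w∈B (λ x x∈P _ → ∈-stop x∈P)
  conditions⇒IsPathToB (step e j P) (p , w∈B , v∉B ∷ rest)
    with conditions⇒IsPathToB P (tail p , w∈B , rest)
  ... | pathToB _ _ only =
    pathToB p w∈B λ { x (here refl) x∈B → ⊥-elim (v∉B x∈B) ; x (there x∈P) → only x x∈P }

  IsPathToB⇒conditions : ∀ {B} (P : Walk G v w) → IsPathToB B P → PathToBConditions B P
  IsPathToB⇒conditions (stop _) (pathToB p w∈B _) = p , w∈B , []
  IsPathToB⇒conditions {B = B} (step {u = u} e j P) (pathToB p w∈B only) =
    p , w∈B , u∉B ∷ proj₂ (proj₂ (IsPathToB⇒conditions P tail-toB))
    where
      tail-toB = pathToB (tail p) w∈B (λ x x∈P → only x (there x∈P))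
      u∉B : ¬ B u
      u∉B u∈B = source∉tail p (subst (_∈ᵥ P) (sym (only u (here refl) u∈B)) (target∈ P))

  IsPathToB⇒PathToB : ∀ {B} (P : Walk G v w) → IsPathToB B P → PathToB G B v
  IsPathToB⇒PathToB P q = _ , P , IsPathToB⇒conditions P q

  inner-avoids : ∀ {B} (P : Walk G u w) → IsPath G P → MeetsOnlyAtEnds B P →
    All (λ x → ¬ B x) (inner G P)
  inner-avoids (stop _) _ _ = []
  inner-avoids (step e j (stop _)) _ _ = []
  inner-avoids {u} {w} {B} (step e j (step {u = v} e′ j′ P)) p onlyAtEnds =
    v∉B ∷ inner-avoids (step e′ j′ P) (tail p) onlyAtEnds′
    where
      v∉B : ¬ B v
      v∉B v∈B with onlyAtEnds v (there (here refl)) v∈B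
      ... | inj₁ refl = source∉tail p (here refl)
      ... | inj₂ refl = source∉tail (tail p) (target∈ P)
      onlyAtEnds′ : MeetsOnlyAtEnds B (step e′ j′ P)
      onlyAtEnds′ x x∈P x∈B with onlyAtEnds x (there x∈P) x∈B
      ... | inj₁ refl = ⊥-elim (source∉tail p x∈P)
      ... | inj₂ x≡w = inj₂ x≡w

  IsBPath-intro : ∀ {B} (P : Walk G u w) → IsPath G P → u ≢ w → B u → B w → MeetsOnlyAtEnds B P →
    IsBPath G B P
  IsBPath-intro (stop _) _ u≢u _ _ _ = ⊥-elim (u≢u refl)
  IsBPath-intro (step e j P) p _ u∈B w∈B onlyAtEnds =
    p , tt , u∈B , w∈B , inner-avoids (step e j P) p onlyAtEnds

  record TripodAt (B : V → Set) (v : V) : Set where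
    constructor tripodAt
    field
      {x₁ x₂ x₃} : V
      {X} : Walk G v x₁
      {Y} : Walk G v x₂
      {Z} : Walk G v x₃
      isTripod : Tripod B X Y Z

  record PrefixToB (B : V → Set) (R : Walk G v w) : Set where
    constructor prefix
    field
      {end} : V
      walk : Walk G v end
      isPathToB : IsPathToB B walk
      ⊆R : ∀ {x} → x ∈ᵥ walk → x ∈ᵥ R

  firstPrefixToB : ∀ {B B′} → (∀ {x} → B x → B′ x) → Decidable B′ →
    (R : Walk G v w) → IsPathToB B R → PrefixToB B′ R
  firstPrefixToB B⊆B′ B′? R R-toB with firstHit _ B′? R
  ... | miss avoids = ⊥-elim (avoids _ (target∈ R) (B⊆B′ (IsPathToB.target∈B R-toB)))
  ... | hit T T′ refl t∈B′ first =
    prefix T (pathToB (IsPath-prefix T T′ (IsPathToB.isPath R-toB)) t∈B′ first) (∈-++⁺ˡ T T′)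

  Tripod-prefixes : ∀ {B B′} {X : Walk G v x} {Y : Walk G v u} {Z : Walk G v w} → Tripod B X Y Z →
    (X′ : PrefixToB B′ X) (Y′ : PrefixToB B′ Y) (Z′ : PrefixToB B′ Z) →
    Tripod B′ (PrefixToB.walk X′) (PrefixToB.walk Y′) (PrefixToB.walk Z′)
  Tripod-prefixes (tripod _ _ _ X∩Y X∩Z Y∩Z) (prefix _ X′ X⊆) (prefix _ Y′ Y⊆) (prefix _ Z′ Z⊆) =
    tripod X′ Y′ Z′ (λ a p q → X∩Y a (X⊆ p) (Y⊆ q)) (λ a p q → X∩Z a (X⊆ p) (Z⊆ q))
      (λ a p q → Y∩Z a (Y⊆ p) (Z⊆ q))

module Weights {c ℓ : Level} (Γ : AbelianGroup c ℓ) (G : LGraph (AbelianGroup.Carrier Γ)) where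
  open AbelianGroup Γ renaming (refl to ≈-refl; sym to ≈-sym; trans to ≈-trans)
  open GroupProperties group using (inverseˡ-unique)
  open Walks G

  private variable
    u v w : V

  wt : Walk G u w → Carrier
  wt = weight Γ {G}

  weight-++ : (P : Walk G u v) (Q : Walk G v w) → wt (P ++ Q) ≈ wt P ∙ wt Q
  weight-++ (stop _) Q = ≈-sym (identityˡ _)
  weight-++ (step e j P) Q = ≈-trans (∙-congˡ (weight-++ P Q)) (≈-sym (assoc _ _ _))

  weight-reverse : (P : Walk G u w) → wt (reverse P) ≈ wt P
  weight-reverse (stop _) = ≈-refl
  weight-reverse (step e j P) =
    ≈-trans (weight-++ (reverse P) _) (≈-trans (∙-cong (weight-reverse P) (identityʳ _)) (comm _ _))

  x∙z≈ε⇒y∙z≈ε⇒x≈y : ∀ {x y z} → x ∙ z ≈ ε → y ∙ z ≈ ε → x ≈ y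
  x∙z≈ε⇒y∙z≈ε⇒x≈y {x} {y} {z} p q =
    ≈-trans (inverseˡ-unique x z p) (≈-sym (inverseˡ-unique y z q))

  x∙x≈ε⇒y∙[s∙x]≈ε⇒s∙y≈x : ∀ {s x y} → x ∙ x ≈ ε → y ∙ (s ∙ x) ≈ ε → s ∙ y ≈ x
  x∙x≈ε⇒y∙[s∙x]≈ε⇒s∙y≈x {s} {x} {y} xx ysx =
    x∙z≈ε⇒y∙z≈ε⇒x≈y (≈-trans (∙-congʳ (comm s y)) (≈-trans (assoc y s x) ysx)) xx

  BPathsZero : (V → Set) → Set ℓ
  BPathsZero B = ∀ {a b} (P : Walk G a b) → IsPath G P → a ≢ b → B a → B b →
    MeetsOnlyAtEnds B P → wt P ≈ ε

  module OverB (B : V → Set) (B? : Decidable B) (BPaths≈ε : BPathsZero B) where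

    weight-pathToB-fromB : (P : Walk G v w) → IsPathToB B P → B v → wt P ≈ ε
    weight-pathToB-fromB (stop _) _ _ = ≈-refl
    weight-pathToB-fromB (step {u = v} e j P) (pathToB p _ only) v∈B with only v (here refl) v∈B
    ... | refl = ⊥-elim (Unique[x∷xs]⇒x∉xs p (target∈ P))

    disjointPathsToB-inverse : (R₁ : Walk G v u) (R₂ : Walk G v w) →
      IsPathToB B R₁ → IsPathToB B R₂ → MeetOnlyAt v R₁ R₂ → wt R₁ ∙ wt R₂ ≈ ε
    disjointPathsToB-inverse {v} R₁ R₂ R₁-toB R₂-toB meet with B? v
    ... | yes v∈B =
      ≈-trans (∙-cong (weight-pathToB-fromB R₁ R₁-toB v∈B) (weight-pathToB-fromB R₂ R₂-toB v∈B))
              (identityˡ ε)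
    ... | no v∉B =
      ≈-trans (≈-sym (≈-trans (weight-++ (reverse R₁) R₂) (∙-congʳ (weight-reverse R₁))))
              (BPaths≈ε (reverse R₁ ++ R₂) R-path ends-differ (target∈B R₁-toB) (target∈B R₂-toB) onlyAtEnds)
      where
        open IsPathToB
        R-path : IsPath G (reverse R₁ ++ R₂)
        R-path = IsPath-++ (reverse R₁) R₂ (IsPath-reverse R₁ (isPath R₁-toB)) (isPath R₂-toB)
                   (λ x p q → meet x (∈-reverse⁻ R₁ p) q)
        ends-differ : _ ≢ _
        ends-differ refl = v∉B (subst B (meet _ (target∈ R₁) (target∈ R₂)) (target∈B R₁-toB))
        onlyAtEnds : MeetsOnlyAtEnds B (reverse R₁ ++ R₂)
        onlyAtEnds x x∈R x∈B with ∈-++⁻ (reverse R₁) R₂ x∈R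
        ... | inj₁ x∈R₁ = inj₁ (meetsBOnlyAtTarget R₁-toB x (∈-reverse⁻ R₁ x∈R₁) x∈B)
        ... | inj₂ x∈R₂ = inj₂ (meetsBOnlyAtTarget R₂-toB x x∈R₂ x∈B)

    tripod-weight∈Γ₂ : ∀ {x y z} {X : Walk G v x} {Y : Walk G v y} {Z : Walk G v z} →
      Tripod B X Y Z → InΓ₂ Γ (wt X)
    tripod-weight∈Γ₂ {X = X} {Y} {Z} (tripod X-toB Y-toB Z-toB X∩Y X∩Z Y∩Z) =
      ≈-trans (∙-congˡ (x∙z≈ε⇒y∙z≈ε⇒x≈y (disjointPathsToB-inverse X Z X-toB Z-toB X∩Z)
                                         (disjointPathsToB-inverse Y Z Y-toB Z-toB Y∩Z)))
              (disjointPathsToB-inverse X Y X-toB Y-toB X∩Y)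

    DetourClaim : ℕ → Set ℓ
    DetourClaim n = ∀ {v s b x y z} (P : Walk G v s) (Q : Walk G s b) (X : Walk G s x)
      {Y : Walk G v y} {Z : Walk G v z} → IsPathToB B (P ++ Q) → Tripod B (P ++ X) Y Z →
      length Q ≤ n → wt (P ++ Q) ≈ wt (P ++ X)

    -- P is a common prefix of Q and X; after s, Q takes the edge e and first meets
    -- the tripod again at t.
    module Detour (n : ℕ) (ih : DetourClaim n) {v s s' t b x y z : V}
      (P : Walk G v s) (e : Fin (LGraph.nE G)) (j : Joins G e s s') (Q₁ : Walk G s' t) (Q₂ : Walk G t b)
      (X₂ : Walk G s x) {Y : Walk G v y} {Z : Walk G v z}
      (Q-toB : IsPathToB B (P ++ step e j (Q₁ ++ Q₂))) (T : Tripod B (P ++ X₂) Y Z)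
      (Q₁₂≤n : length (Q₁ ++ Q₂) ≤ n)
      (first : ∀ u → u ∈ᵥ Q₁ → OnTripod (P ++ X₂) Y Z u → u ≡ t) where

      open IsPathToB
      open Tripod T public

      S : Walk G s t
      S = step e j Q₁

      X : Walk G v x
      X = P ++ X₂

      P-path : IsPath G P
      P-path = IsPath-prefix P (S ++ Q₂) (isPath Q-toB)
      SQ₂-path : IsPath G (S ++ Q₂)
      SQ₂-path = IsPath-suffix P (S ++ Q₂) (isPath Q-toB)
      P∩SQ₂ : MeetOnlyAt s P (S ++ Q₂)
      P∩SQ₂ = IsPath-++⇒MeetOnlyAt P (S ++ Q₂) (isPath Q-toB)
      S-path : IsPath G S
      S-path = IsPath-prefix S Q₂ SQ₂-path
      Q₁∩Q₂ : MeetOnlyAt t Q₁ Q₂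
      Q₁∩Q₂ = IsPath-++⇒MeetOnlyAt Q₁ Q₂ (tail SQ₂-path)
      s∉Q₁₂ : ¬ s ∈ᵥ Q₁ ++ Q₂
      s∉Q₁₂ = Unique[x∷xs]⇒x∉xs SQ₂-path

      PSQ₂-toB : IsPathToB B ((P ++ S) ++ Q₂)
      PSQ₂-toB = subst (IsPathToB B) (sym (++-assoc P S Q₂)) Q-toB
      PS-path : IsPath G (P ++ S)
      PS-path = IsPath-prefix (P ++ S) Q₂ (isPath PSQ₂-toB)
      X₂-path : IsPath G X₂
      X₂-path = IsPath-suffix P X₂ (isPath X-toB)
      P∩X₂ : MeetOnlyAt s P X₂
      P∩X₂ = IsPath-++⇒MeetOnlyAt P X₂ (isPath X-toB)

      t∈Q₁₂ : t ∈ᵥ Q₁ ++ Q₂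
      t∈Q₁₂ = ∈-++⁺ˡ Q₁ Q₂ (target∈ Q₁)
      t∉P : ¬ t ∈ᵥ P
      t∉P t∈P = s∉Q₁₂ (subst (_∈ᵥ Q₁ ++ Q₂) (P∩SQ₂ t t∈P (there t∈Q₁₂)) t∈Q₁₂)
      t≢s : t ≢ s
      t≢s t≡s = s∉Q₁₂ (subst (_∈ᵥ Q₁ ++ Q₂) t≡s t∈Q₁₂)
      t≢v : t ≢ v
      t≢v t≡v = t∉P (subst (_∈ᵥ P) (sym t≡v) (source∈ P))
      s∉B : ¬ B s
      s∉B s∈B = s∉Q₁₂ (subst (_∈ᵥ Q₁ ++ Q₂)
        (sym (meetsBOnlyAtTarget Q-toB s (∈-++⁺ˡ P _ (target∈ P)) s∈B)) (target∈ (Q₁ ++ Q₂)))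

      s∈X : s ∈ᵥ X
      s∈X = ∈-++⁺ˡ P X₂ (target∈ P)
      X₂⊆X : ∀ {u} → u ∈ᵥ X₂ → u ∈ᵥ X
      X₂⊆X = ∈-++⁺ʳ P X₂
      P⊆X : ∀ {u} → u ∈ᵥ P → u ∈ᵥ X
      P⊆X = ∈-++⁺ˡ P X₂

      S-meets : ∀ u → u ∈ᵥ S → OnTripod X Y Z u ⊎ B u → u ≡ s ⊎ u ≡ t
      S-meets u (here u≡s) _ = inj₁ u≡s
      S-meets u (there u∈Q₁) (inj₁ on) = inj₂ (first u u∈Q₁ on)
      S-meets u (there u∈Q₁) (inj₂ u∈B) = inj₂ (Q₁∩Q₂ u u∈Q₁ (subst (_∈ᵥ Q₂)
        (sym (meetsBOnlyAtTarget Q-toB u (∈-++⁺ʳ P _ (there (∈-++⁺ˡ Q₁ Q₂ u∈Q₁))) u∈B)) (target∈ Q₂)))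

      PS-meets : ∀ u → u ∈ᵥ P ++ S → OnTripod X Y Z u ⊎ B u → u ∈ᵥ P ⊎ u ≡ s ⊎ u ≡ t
      PS-meets u u∈PS on with ∈-++⁻ P S u∈PS
      ... | inj₁ u∈P = inj₁ u∈P
      ... | inj₂ u∈S = inj₂ (S-meets u u∈S on)

      Q₂≤n : length Q₂ ≤ n
      Q₂≤n = ≤-trans (length-suffix-≤ Q₁ Q₂) Q₁₂≤n

      weight-reassoc : wt (P ++ S ++ Q₂) ≈ wt ((P ++ S) ++ Q₂)
      weight-reassoc = reflexive (cong wt (sym (++-assoc P S Q₂)))

    -- Rerouting X along S yields a tripod sharing the longer prefix P ++ S with Q.
    module DetourReturnsToX (n : ℕ) (ih : DetourClaim n) {v s s' t b x y z : V}
      (P : Walk G v s) (e : Fin (LGraph.nE G)) (j : Joins G e s s') (Q₁ : Walk G s' t) (Q₂ : Walk G t b)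
      (X₃ : Walk G s t) (X₄ : Walk G t x) {Y : Walk G v y} {Z : Walk G v z}
      (Q-toB : IsPathToB B (P ++ step e j (Q₁ ++ Q₂))) (T : Tripod B (P ++ X₃ ++ X₄) Y Z)
      (Q₁₂≤n : length (Q₁ ++ Q₂) ≤ n)
      (first : ∀ u → u ∈ᵥ Q₁ → OnTripod (P ++ X₃ ++ X₄) Y Z u → u ≡ t) where

      open Detour n ih P e j Q₁ Q₂ (X₃ ++ X₄) Q-toB T Q₁₂≤n first
      open IsPathToB

      X₄-path : IsPath G X₄
      X₄-path = IsPath-suffix X₃ X₄ X₂-path
      s∉X₄ : ¬ s ∈ᵥ X₄
      s∉X₄ s∈X₄ = t≢s (sym (IsPath-++⇒MeetOnlyAt X₃ X₄ X₂-path s (source∈ X₃) s∈X₄))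
      X₄⊆X : ∀ {u} → u ∈ᵥ X₄ → u ∈ᵥ X
      X₄⊆X u∈X₄ = X₂⊆X (∈-++⁺ʳ X₃ X₄ u∈X₄)

      X′ : Walk G v x
      X′ = (P ++ S) ++ X₄

      X′-visits-X : ∀ u → u ∈ᵥ X′ → OnTripod X Y Z u ⊎ B u → u ∈ᵥ X
      X′-visits-X u u∈X′ on with ∈-++⁻ (P ++ S) X₄ u∈X′
      ... | inj₂ u∈X₄ = X₄⊆X u∈X₄
      ... | inj₁ u∈PS with PS-meets u u∈PS on
      ...   | inj₁ u∈P = P⊆X u∈P
      ...   | inj₂ (inj₁ refl) = s∈X
      ...   | inj₂ (inj₂ refl) = X₄⊆X (source∈ X₄)

      PS∩X₄ : MeetOnlyAt t (P ++ S) X₄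
      PS∩X₄ u u∈PS u∈X₄ with PS-meets u u∈PS (inj₁ (inj₁ (X₄⊆X u∈X₄)))
      ... | inj₁ u∈P = ⊥-elim (s∉X₄ (subst (_∈ᵥ X₄) (P∩X₂ u u∈P (∈-++⁺ʳ X₃ X₄ u∈X₄)) u∈X₄))
      ... | inj₂ (inj₁ refl) = ⊥-elim (s∉X₄ u∈X₄)
      ... | inj₂ (inj₂ u≡t) = u≡t

      X′-toB : IsPathToB B X′
      X′-toB = pathToB (IsPath-++ (P ++ S) X₄ PS-path X₄-path PS∩X₄) (target∈B X-toB)
        (λ u u∈X′ u∈B → meetsBOnlyAtTarget X-toB u (X′-visits-X u u∈X′ (inj₂ u∈B)) u∈B)

      T′ : Tripod B X′ Y Z
      T′ = tripod X′-toB Y-toB Z-toB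
        (λ u u∈X′ u∈Y → X∩Y u (X′-visits-X u u∈X′ (inj₁ (inj₂ (inj₁ u∈Y)))) u∈Y)
        (λ u u∈X′ u∈Z → X∩Z u (X′-visits-X u u∈X′ (inj₁ (inj₂ (inj₂ u∈Z)))) u∈Z)
        Y∩Z

      weight≈ : wt (P ++ S ++ Q₂) ≈ wt X
      weight≈ = ≈-trans weight-reassoc (≈-trans (ih (P ++ S) Q₂ X₄ PSQ₂-toB T′ Q₂≤n)
        (x∙z≈ε⇒y∙z≈ε⇒x≈y (disjointPathsToB-inverse X′ Y X′-toB Y-toB (Tripod.X∩Y T′))
                          (disjointPathsToB-inverse X Y X-toB Y-toB X∩Y)))

    module DetourMeetsY (n : ℕ) (ih : DetourClaim n) {v s s' t b x y z : V}
      (P : Walk G v s) (e : Fin (LGraph.nE G)) (j : Joins G e s s') (Q₁ : Walk G s' t) (Q₂ : Walk G t b)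
      (X₂ : Walk G s x) (Y₁ : Walk G v t) (Y₂ : Walk G t y) {Z : Walk G v z}
      (Q-toB : IsPathToB B (P ++ step e j (Q₁ ++ Q₂))) (T : Tripod B (P ++ X₂) (Y₁ ++ Y₂) Z)
      (Q₁₂≤n : length (Q₁ ++ Q₂) ≤ n)
      (first : ∀ u → u ∈ᵥ Q₁ → OnTripod (P ++ X₂) (Y₁ ++ Y₂) Z u → u ≡ t) where

      open Detour n ih P e j Q₁ Q₂ X₂ Q-toB T Q₁₂≤n first
      open IsPathToB

      Y : Walk G v y
      Y = Y₁ ++ Y₂

      Y₁-path : IsPath G Y₁
      Y₁-path = IsPath-prefix Y₁ Y₂ (isPath Y-toB)
      Y₂-path : IsPath G Y₂
      Y₂-path = IsPath-suffix Y₁ Y₂ (isPath Y-toB)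
      Y₁∩Y₂ : MeetOnlyAt t Y₁ Y₂
      Y₁∩Y₂ = IsPath-++⇒MeetOnlyAt Y₁ Y₂ (isPath Y-toB)
      Y₁⊆Y : ∀ {u} → u ∈ᵥ Y₁ → u ∈ᵥ Y
      Y₁⊆Y = ∈-++⁺ˡ Y₁ Y₂
      Y₂⊆Y : ∀ {u} → u ∈ᵥ Y₂ → u ∈ᵥ Y
      Y₂⊆Y = ∈-++⁺ʳ Y₁ Y₂
      t∈Y : t ∈ᵥ Y
      t∈Y = Y₂⊆Y (source∈ Y₂)
      t∉X : ¬ t ∈ᵥ X
      t∉X t∈X = t≢v (X∩Y t t∈X t∈Y)
      t∉Z : ¬ t ∈ᵥ Z
      t∉Z t∈Z = t≢v (Y∩Z t t∈Y t∈Z)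
      v∉Y₂ : ¬ v ∈ᵥ Y₂
      v∉Y₂ v∈Y₂ = t≢v (sym (Y₁∩Y₂ v (source∈ Y₁) v∈Y₂))

      -- P is trivial: reroute Y along S, then X and Y swap roles.
      module AtSource (s≡v : s ≡ v) where

        PS-meets′ : ∀ u → u ∈ᵥ P ++ S → OnTripod X Y Z u ⊎ B u → u ≡ v ⊎ u ≡ t
        PS-meets′ u u∈PS on with PS-meets u u∈PS on
        ... | inj₁ u∈P = inj₁ (closedPath-trivial P P-path s≡v u∈P)
        ... | inj₂ (inj₁ u≡s) = inj₁ (trans u≡s s≡v)
        ... | inj₂ (inj₂ u≡t) = inj₂ u≡t

        Y′ : Walk G v y
        Y′ = (P ++ S) ++ Y₂

        Y′-visits-Y : ∀ u → u ∈ᵥ Y′ → OnTripod X Y Z u ⊎ B u → u ∈ᵥ Y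
        Y′-visits-Y u u∈Y′ on with ∈-++⁻ (P ++ S) Y₂ u∈Y′
        ... | inj₂ u∈Y₂ = Y₂⊆Y u∈Y₂
        ... | inj₁ u∈PS with PS-meets′ u u∈PS on
        ...   | inj₁ refl = source∈ Y
        ...   | inj₂ refl = t∈Y

        PS∩Y₂ : MeetOnlyAt t (P ++ S) Y₂
        PS∩Y₂ u u∈PS u∈Y₂ with PS-meets′ u u∈PS (inj₁ (inj₂ (inj₁ (Y₂⊆Y u∈Y₂))))
        ... | inj₁ refl = ⊥-elim (v∉Y₂ u∈Y₂)
        ... | inj₂ u≡t = u≡t

        Y′-toB : IsPathToB B Y′
        Y′-toB = pathToB (IsPath-++ (P ++ S) Y₂ PS-path Y₂-path PS∩Y₂) (target∈B Y-toB)
          (λ u u∈Y′ u∈B → meetsBOnlyAtTarget Y-toB u (Y′-visits-Y u u∈Y′ (inj₂ u∈B)) u∈B)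

        T′ : Tripod B Y′ X Z
        T′ = tripod Y′-toB X-toB Z-toB
          (λ u u∈Y′ u∈X → X∩Y u u∈X (Y′-visits-Y u u∈Y′ (inj₁ (inj₁ u∈X))))
          (λ u u∈Y′ u∈Z → Y∩Z u (Y′-visits-Y u u∈Y′ (inj₁ (inj₂ (inj₂ u∈Z)))) u∈Z)
          X∩Z

        weight≈ : wt (P ++ S ++ Q₂) ≈ wt X
        weight≈ = ≈-trans weight-reassoc (≈-trans (ih (P ++ S) Q₂ Y₂ PSQ₂-toB T′ Q₂≤n)
          (x∙z≈ε⇒y∙z≈ε⇒x≈y (disjointPathsToB-inverse Y′ Z Y′-toB Z-toB (Tripod.X∩Z T′))
                            (disjointPathsToB-inverse X Z X-toB Z-toB X∩Z)))

      -- Tripods at t (Y₂, reverse S ++ X₂, reverse Y₁ ++ Z) and at s (X₂, reverse P ++ Z,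
      -- S ++ Y₂) give w Q₂ = w Y₂ = -(w S + w X₂) and 2 w X₂ = 0; hence w S + w Q₂ = w X₂.
      module AwayFromSource (s≢v : s ≢ v) where

        s∉Y : ¬ s ∈ᵥ Y
        s∉Y s∈Y = s≢v (X∩Y s s∈X s∈Y)
        s∉Z : ¬ s ∈ᵥ Z
        s∉Z s∈Z = s≢v (X∩Z s s∈X s∈Z)
        v∉X₂ : ¬ v ∈ᵥ X₂
        v∉X₂ v∈X₂ = s≢v (sym (P∩X₂ v (source∈ P) v∈X₂))

        S∩Y : ∀ u → u ∈ᵥ S → u ∈ᵥ Y → u ≡ t
        S∩Y u u∈S u∈Y with S-meets u u∈S (inj₁ (inj₂ (inj₁ u∈Y)))
        ... | inj₁ refl = ⊥-elim (s∉Y u∈Y)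
        ... | inj₂ u≡t = u≡t
        S∩Z-empty : ∀ u → u ∈ᵥ S → ¬ u ∈ᵥ Z
        S∩Z-empty u u∈S u∈Z with S-meets u u∈S (inj₁ (inj₂ (inj₂ u∈Z)))
        ... | inj₁ refl = s∉Z u∈Z
        ... | inj₂ refl = t∉Z u∈Z
        S∩X : ∀ u → u ∈ᵥ S → u ∈ᵥ X → u ≡ s
        S∩X u u∈S u∈X with S-meets u u∈S (inj₁ (inj₁ u∈X))
        ... | inj₁ u≡s = u≡s
        ... | inj₂ refl = ⊥-elim (t∉X u∈X)
        X₂∩Y-empty : ∀ u → u ∈ᵥ X₂ → ¬ u ∈ᵥ Y
        X₂∩Y-empty u u∈X₂ u∈Y with X∩Y u (X₂⊆X u∈X₂) u∈Y
        ... | refl = v∉X₂ u∈X₂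
        X₂∩Z-empty : ∀ u → u ∈ᵥ X₂ → ¬ u ∈ᵥ Z
        X₂∩Z-empty u u∈X₂ u∈Z with X∩Z u (X₂⊆X u∈X₂) u∈Z
        ... | refl = v∉X₂ u∈X₂

        A : Walk G t x
        A = reverse S ++ X₂
        A-path : IsPath G A
        A-path = IsPath-++ (reverse S) X₂ (IsPath-reverse S S-path) X₂-path
          (λ u u∈S u∈X₂ → S∩X u (∈-reverse⁻ S u∈S) (X₂⊆X u∈X₂))
        t≢x : t ≢ x
        t≢x t≡x = t∉X (subst (_∈ᵥ X) (sym t≡x) (X₂⊆X (target∈ X₂)))
        A-meetsB : MeetsOnlyAtEnds B A
        A-meetsB u u∈A u∈B with ∈-++⁻ (reverse S) X₂ u∈A
        ... | inj₂ u∈X₂ = inj₂ (meetsBOnlyAtTarget X-toB u (X₂⊆X u∈X₂) u∈B)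
        ... | inj₁ u∈S with S-meets u (∈-reverse⁻ S u∈S) (inj₂ u∈B)
        ...   | inj₁ refl = ⊥-elim (s∉B u∈B)
        ...   | inj₂ u≡t = inj₁ u≡t

        weight-A : wt A ≈ wt S ∙ wt X₂
        weight-A = ≈-trans (weight-++ (reverse S) X₂) (∙-congʳ (weight-reverse S))

        Q₂-toB : IsPathToB B Q₂
        Q₂-toB = IsPathToB-suffix (P ++ S) Q₂ PSQ₂-toB
        Y₂-toB : IsPathToB B Y₂
        Y₂-toB = IsPathToB-suffix Y₁ Y₂ Y-toB

        module _ (t∉B : ¬ B t) where

          A-toB : IsPathToB B A
          A-toB = pathToB A-path (target∈B X-toB) λ u u∈A u∈B → toTarget u∈B (A-meetsB u u∈A u∈B)
            where
              toTarget : ∀ {u} → B u → u ≡ t ⊎ u ≡ x → u ≡ x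
              toTarget u∈B (inj₁ refl) = ⊥-elim (t∉B u∈B)
              toTarget _ (inj₂ u≡x) = u≡x

          C : Walk G t z
          C = reverse Y₁ ++ Z
          C-toB : IsPathToB B C
          C-toB = pathToB
            (IsPath-++ (reverse Y₁) Z (IsPath-reverse Y₁ Y₁-path) (isPath Z-toB)
              (λ u u∈Y₁ u∈Z → Y∩Z u (Y₁⊆Y (∈-reverse⁻ Y₁ u∈Y₁)) u∈Z))
            (target∈B Z-toB) C-meetsB
            where
              C-meetsB : ∀ u → u ∈ᵥ C → B u → u ≡ z
              C-meetsB u u∈C u∈B with ∈-++⁻ (reverse Y₁) Z u∈C
              ... | inj₂ u∈Z = meetsBOnlyAtTarget Z-toB u u∈Z u∈B
              ... | inj₁ u∈Y₁ with meetsBOnlyAtTarget Y-toB u (Y₁⊆Y (∈-reverse⁻ Y₁ u∈Y₁)) u∈B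
              ...   | refl with Y₁∩Y₂ u (∈-reverse⁻ Y₁ u∈Y₁) (target∈ Y₂)
              ...     | refl = ⊥-elim (t∉B u∈B)

          T-at-t : Tripod B Y₂ A C
          T-at-t = tripod Y₂-toB A-toB C-toB Y₂∩A Y₂∩C A∩C
            where
              Y₂∩A : MeetOnlyAt t Y₂ A
              Y₂∩A u u∈Y₂ u∈A with ∈-++⁻ (reverse S) X₂ u∈A
              ... | inj₁ u∈S = S∩Y u (∈-reverse⁻ S u∈S) (Y₂⊆Y u∈Y₂)
              ... | inj₂ u∈X₂ = ⊥-elim (X₂∩Y-empty u u∈X₂ (Y₂⊆Y u∈Y₂))
              Y₂∩C : MeetOnlyAt t Y₂ C
              Y₂∩C u u∈Y₂ u∈C with ∈-++⁻ (reverse Y₁) Z u∈C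
              ... | inj₁ u∈Y₁ = Y₁∩Y₂ u (∈-reverse⁻ Y₁ u∈Y₁) u∈Y₂
              ... | inj₂ u∈Z with Y∩Z u (Y₂⊆Y u∈Y₂) u∈Z
              ...   | refl = ⊥-elim (v∉Y₂ u∈Y₂)
              A∩C : MeetOnlyAt t A C
              A∩C u u∈A u∈C with ∈-++⁻ (reverse S) X₂ u∈A | ∈-++⁻ (reverse Y₁) Z u∈C
              ... | inj₁ u∈S | inj₁ u∈Y₁ = S∩Y u (∈-reverse⁻ S u∈S) (Y₁⊆Y (∈-reverse⁻ Y₁ u∈Y₁))
              ... | inj₁ u∈S | inj₂ u∈Z = ⊥-elim (S∩Z-empty u (∈-reverse⁻ S u∈S) u∈Z)
              ... | inj₂ u∈X₂ | inj₁ u∈Y₁ = ⊥-elim (X₂∩Y-empty u u∈X₂ (Y₁⊆Y (∈-reverse⁻ Y₁ u∈Y₁)))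
              ... | inj₂ u∈X₂ | inj₂ u∈Z = ⊥-elim (X₂∩Z-empty u u∈X₂ u∈Z)

        weights-at-t : (wt Q₂ ≈ wt Y₂) × (wt Y₂ ∙ wt A ≈ ε)
        weights-at-t with B? t
        ... | yes t∈B =
          ≈-trans (weight-pathToB-fromB Q₂ Q₂-toB t∈B) (≈-sym (weight-pathToB-fromB Y₂ Y₂-toB t∈B)) ,
          ≈-trans (∙-cong (weight-pathToB-fromB Y₂ Y₂-toB t∈B)
                          (BPaths≈ε A A-path t≢x t∈B (target∈B X-toB) A-meetsB))
                  (identityˡ ε)
        ... | no t∉B = ih (stop t) Q₂ Y₂ Q₂-toB (T-at-t t∉B) Q₂≤n ,
          disjointPathsToB-inverse Y₂ A Y₂-toB (A-toB t∉B) (Tripod.X∩Y (T-at-t t∉B))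

        T-at-s : Tripod B X₂ (reverse P ++ Z) (S ++ Y₂)
        T-at-s = tripod (IsPathToB-suffix P X₂ X-toB) D-toB E-toB X₂∩D X₂∩E D∩E
          where
            D = reverse P ++ Z
            E = S ++ Y₂
            D-toB : IsPathToB B D
            D-toB = pathToB
              (IsPath-++ (reverse P) Z (IsPath-reverse P P-path) (isPath Z-toB)
                (λ u u∈P u∈Z → X∩Z u (P⊆X (∈-reverse⁻ P u∈P)) u∈Z))
              (target∈B Z-toB) D-meetsB
              where
                D-meetsB : ∀ u → u ∈ᵥ D → B u → u ≡ z
                D-meetsB u u∈D u∈B with ∈-++⁻ (reverse P) Z u∈D
                ... | inj₂ u∈Z = meetsBOnlyAtTarget Z-toB u u∈Z u∈B
                ... | inj₁ u∈P with meetsBOnlyAtTarget X-toB u (P⊆X (∈-reverse⁻ P u∈P)) u∈B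
                ...   | refl with P∩X₂ u (∈-reverse⁻ P u∈P) (target∈ X₂)
                ...     | refl = ⊥-elim (s∉B u∈B)
            E-toB : IsPathToB B E
            E-toB = pathToB (IsPath-++ S Y₂ S-path Y₂-path (λ u u∈S u∈Y₂ → S∩Y u u∈S (Y₂⊆Y u∈Y₂)))
              (target∈B Y-toB) E-meetsB
              where
                E-meetsB : ∀ u → u ∈ᵥ E → B u → u ≡ y
                E-meetsB u u∈E u∈B with ∈-++⁻ S Y₂ u∈E
                ... | inj₂ u∈Y₂ = meetsBOnlyAtTarget Y-toB u (Y₂⊆Y u∈Y₂) u∈B
                ... | inj₁ u∈S with S-meets u u∈S (inj₂ u∈B)
                ...   | inj₁ refl = ⊥-elim (s∉B u∈B)
                ...   | inj₂ refl = meetsBOnlyAtTarget Y-toB u t∈Y u∈B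
            X₂∩D : MeetOnlyAt s X₂ D
            X₂∩D u u∈X₂ u∈D with ∈-++⁻ (reverse P) Z u∈D
            ... | inj₁ u∈P = P∩X₂ u (∈-reverse⁻ P u∈P) u∈X₂
            ... | inj₂ u∈Z = ⊥-elim (X₂∩Z-empty u u∈X₂ u∈Z)
            X₂∩E : MeetOnlyAt s X₂ E
            X₂∩E u u∈X₂ u∈E with ∈-++⁻ S Y₂ u∈E
            ... | inj₁ u∈S = S∩X u u∈S (X₂⊆X u∈X₂)
            ... | inj₂ u∈Y₂ = ⊥-elim (X₂∩Y-empty u u∈X₂ (Y₂⊆Y u∈Y₂))
            D∩E : MeetOnlyAt s D E
            D∩E u u∈D u∈E with ∈-++⁻ (reverse P) Z u∈D | ∈-++⁻ S Y₂ u∈E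
            ... | inj₁ u∈P | inj₁ u∈S = P∩SQ₂ u (∈-reverse⁻ P u∈P) (∈-++⁺ˡ S Q₂ u∈S)
            ... | inj₁ u∈P | inj₂ u∈Y₂ with X∩Y u (P⊆X (∈-reverse⁻ P u∈P)) (Y₂⊆Y u∈Y₂)
            ...   | refl = ⊥-elim (v∉Y₂ u∈Y₂)
            D∩E u u∈D u∈E | inj₂ u∈Z | inj₁ u∈S = ⊥-elim (S∩Z-empty u u∈S u∈Z)
            D∩E u u∈D u∈E | inj₂ u∈Z | inj₂ u∈Y₂ with Y∩Z u (Y₂⊆Y u∈Y₂) u∈Z
            ...   | refl = ⊥-elim (v∉Y₂ u∈Y₂)

        weight≈ : wt (P ++ S ++ Q₂) ≈ wt X
        weight≈ = begin
          wt (P ++ S ++ Q₂)        ≈⟨ weight-++ P (S ++ Q₂) ⟩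
          wt P ∙ wt (S ++ Q₂)      ≈⟨ ∙-congˡ (weight-++ S Q₂) ⟩
          wt P ∙ (wt S ∙ wt Q₂)    ≈⟨ ∙-congˡ (x∙x≈ε⇒y∙[s∙x]≈ε⇒s∙y≈x (tripod-weight∈Γ₂ T-at-s) Y₂-inverts) ⟩
          wt P ∙ wt X₂             ≈⟨ weight-++ P X₂ ⟨
          wt X                     ∎
          where
            open ≈-Reasoning setoid
            Y₂-inverts : wt Q₂ ∙ (wt S ∙ wt X₂) ≈ ε
            Y₂-inverts = ≈-trans (∙-cong (proj₁ weights-at-t) (≈-sym weight-A)) (proj₂ weights-at-t)

      weight≈ : wt (P ++ S ++ Q₂) ≈ wt X
      weight≈ with s ≟ v
      ... | yes s≡v = AtSource.weight≈ s≡v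
      ... | no s≢v = AwayFromSource.weight≈ s≢v

    detour-step : ∀ n → DetourClaim n → ∀ {v s s' b x y z} (P : Walk G v s) (e : Fin (LGraph.nE G))
      (j : Joins G e s s') (Q : Walk G s' b) (X₂ : Walk G s x) {Y : Walk G v y} {Z : Walk G v z} →
      IsPathToB B (P ++ step e j Q) → Tripod B (P ++ X₂) Y Z → length Q ≤ n →
      wt (P ++ step e j Q) ≈ wt (P ++ X₂)
    detour-step n ih {v} P e j Q X₂ {Y} {Z} Q-toB T Q≤n
      with firstHit (OnTripod (P ++ X₂) Y Z) (onTripod? (P ++ X₂) Y Z) Q
    ... | miss avoids = x∙z≈ε⇒y∙z≈ε⇒x≈y
      (disjointPathsToB-inverse (P ++ step e j Q) Y Q-toB Y-toB PQ∩Y)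
      (disjointPathsToB-inverse (P ++ X₂) Y X-toB Y-toB X∩Y)
      where
        open Tripod T
        PQ∩Y : MeetOnlyAt v (P ++ step e j Q) Y
        PQ∩Y u u∈PQ u∈Y with ∈-++⁻ P (step e j Q) u∈PQ
        ... | inj₁ u∈P = X∩Y u (∈-++⁺ˡ P X₂ u∈P) u∈Y
        ... | inj₂ (here refl) = X∩Y u (∈-++⁺ʳ P X₂ (source∈ X₂)) u∈Y
        ... | inj₂ (there u∈Q) = ⊥-elim (avoids u u∈Q (inj₂ (inj₁ u∈Y)))
    ... | hit Q₁ Q₂ refl (inj₁ t∈X) first with ∈-++⁻ P X₂ t∈X
    ...   | inj₁ t∈P = ⊥-elim (Detour.t∉P n ih P e j Q₁ Q₂ X₂ Q-toB T Q≤n first t∈P)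
    ...   | inj₂ t∈X₂ with splitAt X₂ t∈X₂
    ...     | X₃ , X₄ , refl = DetourReturnsToX.weight≈ n ih P e j Q₁ Q₂ X₃ X₄ Q-toB T Q≤n first
    detour-step n ih P e j Q X₂ Q-toB T Q≤n | hit Q₁ Q₂ refl (inj₂ (inj₁ t∈Y)) first
      with splitAt _ t∈Y
    ... | Y₁ , Y₂ , refl = DetourMeetsY.weight≈ n ih P e j Q₁ Q₂ X₂ Y₁ Y₂ Q-toB T Q≤n first
    detour-step n ih P e j Q X₂ Q-toB T Q≤n | hit Q₁ Q₂ refl (inj₂ (inj₂ t∈Z)) first
      with splitAt _ t∈Z
    ... | Z₁ , Z₂ , refl = DetourMeetsY.weight≈ n ih P e j Q₁ Q₂ X₂ Z₁ Z₂ Q-toB (Tripod-swap₂₃ T) Q≤n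
          (λ u u∈Q₁ on → first u u∈Q₁ (swap₂₃ on))
      where
        swap₂₃ : ∀ {A B C : Set} → A ⊎ B ⊎ C → A ⊎ C ⊎ B
        swap₂₃ (inj₁ a) = inj₁ a
        swap₂₃ (inj₂ (inj₁ b)) = inj₂ (inj₂ b)
        swap₂₃ (inj₂ (inj₂ c)) = inj₂ (inj₁ c)

    detourClaim : ∀ n → DetourClaim n
    detourClaim n P (stop s) X₂ Q-toB T _ =
      ≈-trans (weight-++ P (stop s))
        (≈-trans (∙-congˡ (≈-sym (weight-pathToB-fromB X₂ X₂-toB (IsPathToB.target∈B Q-toB))))
          (≈-sym (weight-++ P X₂)))
      where
        X₂-toB = IsPathToB-suffix P X₂ (Tripod.X-toB T)
    detourClaim zero P (step e j Q) X₂ Q-toB T ()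
    detourClaim (suc n) P (step e j Q) X₂ Q-toB T (s≤s Q≤n) =
      detour-step n (detourClaim n) P e j Q X₂ Q-toB T Q≤n

    tripod-determines-weight : ∀ {v b x y z} (Q : Walk G v b) {X : Walk G v x} {Y : Walk G v y} {Z : Walk G v z} →
      IsPathToB B Q → Tripod B X Y Z → wt Q ≈ wt X
    tripod-determines-weight {v} Q Q-toB T = detourClaim (length Q) (stop v) Q _ Q-toB T ≤-refl

    pathBetweenB-weight≈ε : ∀ n {a b} (P : Walk G a b) → IsPath G P → B a → B b → length P ≤ n →
      wt P ≈ ε
    pathBetweenB-weight≈ε n (stop _) _ _ _ _ = ≈-refl
    pathBetweenB-weight≈ε zero (step e j P) _ _ _ ()
    pathBetweenB-weight≈ε (suc n) {a} {b} (step e j P) path a∈B b∈B (s≤s P≤n) with firstHit B B? P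
    ... | miss avoids = ⊥-elim (avoids b (target∈ P) b∈B)
    ... | hit {t = t} P₁ P₂ refl t∈B first = begin
        wt (step e j P₁ ++ P₂)        ≈⟨ weight-++ (step e j P₁) P₂ ⟩
        wt (step e j P₁) ∙ wt P₂      ≈⟨ ∙-cong (BPaths≈ε (step e j P₁) P₁-path a≢t a∈B t∈B onlyAtEnds)
                                                (pathBetweenB-weight≈ε n P₂ P₂-path t∈B b∈B P₂≤n) ⟩
        ε ∙ ε                         ≈⟨ identityˡ ε ⟩
        ε                             ∎
      where
        open ≈-Reasoning setoid
        P₁-path : IsPath G (step e j P₁)
        P₁-path = IsPath-prefix (step e j P₁) P₂ path
        P₂-path : IsPath G P₂
        P₂-path = IsPath-suffix (step e j P₁) P₂ path
        P₂≤n : length P₂ ≤ n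
        P₂≤n = ≤-trans (length-suffix-≤ P₁ P₂) P≤n
        a≢t : a ≢ t
        a≢t refl = Unique[x∷xs]⇒x∉xs path (∈-++⁺ˡ P₁ P₂ (target∈ P₁))
        onlyAtEnds : MeetsOnlyAtEnds B (step e j P₁)
        onlyAtEnds u (here u≡a) _ = inj₁ u≡a
        onlyAtEnds u (there u∈P₁) u∈B = inj₂ (first u u∈P₁ u∈B)

module ZeroBPaths {c ℓ : Level} (Γ : AbelianGroup c ℓ) (G : LGraph (AbelianGroup.Carrier Γ))
  (Bs : Subset (LGraph.nV G))
  (BPath≈ε : ∀ {x y} (P : Walk G x y) → IsBPath G (_∈ Bs) P →
    AbelianGroup._≈_ Γ (weight Γ {G} P) (AbelianGroup.ε Γ)) where
  open AbelianGroup Γ renaming (refl to ≈-refl; sym to ≈-sym; trans to ≈-trans)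
  open Walks G
  open Weights Γ G

  B : V → Set
  B = _∈ Bs

  BPaths≈ε : BPathsZero B
  BPaths≈ε P p a≢b a∈B b∈B onlyAtEnds = BPath≈ε P (IsBPath-intro P p a≢b a∈B b∈B onlyAtEnds)

  open OverB B (_∈? Bs) BPaths≈ε

  -- The three paths of InM end in B ∖ {v}; when v ∉ B they are simply paths to B.
  InM⇒TripodAt : ∀ {v} → ¬ B v → InM Γ G B v → TripodAt B v
  InM⇒TripodAt {v} v∉B ((_ , X , cX) , (_ , Y , cY) , (_ , Z , cZ) , X∩Y , X∩Z , Y∩Z) =
    tripodAt (tripod (toB X cX) (toB Y cY) (toB Z cZ) X∩Y X∩Z Y∩Z)
    where
      toB : ∀ {a} (R : Walk G v a) → PathToBConditions (λ x → B x × x ≢ v) R → IsPathToB B R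
      toB R conds with conditions⇒IsPathToB R conds
      ... | pathToB p (a∈B , _) only =
        pathToB p a∈B λ x x∈R x∈B → only x x∈R (x∈B , λ { refl → v∉B x∈B })

  pathsToB-weight∈Γ₂ : (v : V) → InM Γ G B v →
    Σ Carrier λ γ → InΓ₂ Γ γ × AllPathsToBWeigh Γ G B v γ
  pathsToB-weight∈Γ₂ v v∈M with v ∈? Bs
  ... | yes v∈B = ε , identityˡ ε ,
    λ { (_ , Q , conds) → weight-pathToB-fromB Q (conditions⇒IsPathToB Q conds) v∈B }
  ... | no v∉B with InM⇒TripodAt v∉B v∈M
  ...   | tripodAt {X = X} T = wt X , tripod-weight∈Γ₂ T ,
    λ { (_ , Q , conds) → tripod-determines-weight Q (conditions⇒IsPathToB Q conds) T }

  module ZeroBetween {v w : V} (v∈M : InM Γ G B v)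
    (v-zero : AllPathsToBWeigh Γ G B v ε) (w-zero : AllPathsToBWeigh Γ G B w ε) where

    B⁺ : V → Set
    B⁺ x = B x ⊎ x ≡ w

    B⁺? : Decidable B⁺
    B⁺? x = (x ∈? Bs) ⊎-dec (x ≟ w)

    B⁺Paths≈ε : BPathsZero B⁺
    B⁺Paths≈ε {a} {b} P p a≢b a∈B⁺ b∈B⁺ onlyAtEnds with w ∈? Bs
    ... | yes w∈B = BPaths≈ε P p a≢b (toB a∈B⁺) (toB b∈B⁺) (MeetsOnlyAtEnds-⊆ inj₁ onlyAtEnds)
      where
        toB : ∀ {x} → B⁺ x → B x
        toB (inj₁ x∈B) = x∈B
        toB (inj₂ refl) = w∈B
    ... | no w∉B = byEnds a∈B⁺ b∈B⁺
      where
        byEnds : B⁺ a → B⁺ b → wt P ≈ ε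
        byEnds (inj₁ a∈B) (inj₁ b∈B) = BPaths≈ε P p a≢b a∈B b∈B (MeetsOnlyAtEnds-⊆ inj₁ onlyAtEnds)
        byEnds (inj₂ refl) (inj₁ b∈B) = w-zero (IsPathToB⇒PathToB P (pathToB p b∈B onlyAtTarget))
          where
            onlyAtTarget : ∀ x → x ∈ᵥ P → B x → x ≡ b
            onlyAtTarget x x∈P x∈B with onlyAtEnds x x∈P (inj₁ x∈B)
            ... | inj₁ refl = ⊥-elim (w∉B x∈B)
            ... | inj₂ x≡b = x≡b
        byEnds (inj₁ a∈B) (inj₂ refl) = ≈-trans (≈-sym (weight-reverse P))
          (w-zero (IsPathToB⇒PathToB (reverse P) (pathToB (IsPath-reverse P p) a∈B onlyAtTarget)))
          where
            onlyAtTarget : ∀ x → x ∈ᵥ reverse P → B x → x ≡ a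
            onlyAtTarget x x∈P x∈B with onlyAtEnds x (∈-reverse⁻ P x∈P) (inj₁ x∈B)
            ... | inj₁ x≡a = x≡a
            ... | inj₂ refl = ⊥-elim (w∉B x∈B)
        byEnds (inj₂ refl) (inj₂ refl) = ⊥-elim (a≢b refl)

    module M⁺ = OverB B⁺ B⁺? B⁺Paths≈ε

    tripodAvoiding-w⇒pathsToB⁺≈ε : ∀ {x y z} {X : Walk G v x} {Y : Walk G v y} {Z : Walk G v z} →
      Tripod B X Y Z → ¬ w ∈ᵥ X → ∀ {a} (Q : Walk G v a) → IsPathToB B⁺ Q → wt Q ≈ ε
    tripodAvoiding-w⇒pathsToB⁺≈ε {X = X} {Y} {Z} T@(tripod X-toB Y-toB Z-toB _ _ _) w∉X Q Q-toB⁺ =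
      ≈-trans (M⁺.tripod-determines-weight Q Q-toB⁺ (Tripod-prefixes T X′ (cut Y Y-toB) (cut Z Z-toB)))
              (v-zero (IsPathToB⇒PathToB (PrefixToB.walk X′) X′-toB))
      where
        cut : ∀ {a} (R : Walk G v a) → IsPathToB B R → PrefixToB B⁺ R
        cut = firstPrefixToB inj₁ B⁺?
        X′ : PrefixToB B⁺ X
        X′ = cut X X-toB
        X′-toB : IsPathToB B (PrefixToB.walk X′)
        X′-toB with X′
        ... | prefix X₁ (pathToB p end∈B⁺ only) ⊆X =
          pathToB p (toB end∈B⁺) (λ x x∈X₁ x∈B → only x x∈X₁ (inj₁ x∈B))
          where
            toB : B⁺ _ → B _
            toB (inj₁ end∈B) = end∈B
            toB (inj₂ refl) = ⊥-elim (w∉X (⊆X (target∈ X₁)))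

    pathsToB⁺≈ε : ¬ B⁺ v → ∀ {a} (Q : Walk G v a) → IsPathToB B⁺ Q → wt Q ≈ ε
    pathsToB⁺≈ε v∉B⁺ with InM⇒TripodAt (v∉B⁺ ∘ inj₁) v∈M
    ... | tripodAt {X = X} T with w ∈ᵥ? X
    ...   | no w∉X = tripodAvoiding-w⇒pathsToB⁺≈ε T w∉X
    ...   | yes w∈X = tripodAvoiding-w⇒pathsToB⁺≈ε (Tripod-swap₁₂ T)
            (λ w∈Y → v∉B⁺ (inj₂ (sym (Tripod.X∩Y T w w∈X w∈Y))))

    path≈ε : (P : Walk G v w) → IsPath G P → wt P ≈ ε
    path≈ε P p with B⁺? v
    ... | yes v∈B⁺ = M⁺.pathBetweenB-weight≈ε (length P) P p v∈B⁺ (inj₂ refl) ≤-refl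
    ... | no v∉B⁺ with firstHit B⁺ B⁺? P
    ...   | miss avoids = ⊥-elim (avoids w (target∈ P) (inj₂ refl))
    ...   | hit P₁ P₂ refl t∈B⁺ first = begin
      wt (P₁ ++ P₂)    ≈⟨ weight-++ P₁ P₂ ⟩
      wt P₁ ∙ wt P₂    ≈⟨ ∙-cong (pathsToB⁺≈ε v∉B⁺ P₁ (pathToB (IsPath-prefix P₁ P₂ p) t∈B⁺ first))
                                 (M⁺.pathBetweenB-weight≈ε (length P₂) P₂ P₂-path t∈B⁺ (inj₂ refl) ≤-refl) ⟩
      ε ∙ ε            ≈⟨ identityˡ ε ⟩
      ε                ∎
      where
        open ≈-Reasoning setoid
        P₂-path = IsPath-suffix P₁ P₂ p

lemma3p2 : {c ℓ : Level} (Γ : AbelianGroup c ℓ) (G : LGraph (AbelianGroup.Carrier Γ))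
  (B : Subset (LGraph.nV G)) →
  ({x y : Fin (LGraph.nV G)} (P : Walk G x y) →
    IsBPath G (_∈ B) P → AbelianGroup._≈_ Γ (weight Γ {G} P) (AbelianGroup.ε Γ)) →
  ((v : Fin (LGraph.nV G)) → InM Γ G (_∈ B) v →
    Σ (AbelianGroup.Carrier Γ) λ γ → InΓ₂ Γ γ × AllPathsToBWeigh Γ G (_∈ B) v γ)
  × ((v w : Fin (LGraph.nV G)) → InM Γ G (_∈ B) v → InM Γ G (_∈ B) w →
    AllPathsToBWeigh Γ G (_∈ B) v (AbelianGroup.ε Γ) →
    AllPathsToBWeigh Γ G (_∈ B) w (AbelianGroup.ε Γ) →
    (P : Walk G v w) → IsPath G P → AbelianGroup._≈_ Γ (weight Γ {G} P) (AbelianGroup.ε Γ))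
lemma3p2 Γ G B BPath≈ε =
  ZeroBPaths.pathsToB-weight∈Γ₂ Γ G B BPath≈ε ,
  λ v w v∈M _ v-zero w-zero → ZeroBPaths.ZeroBetween.path≈ε Γ G B BPath≈ε v∈M v-zero w-zero
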